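{- Let $k\geq 2$ be an integer, let $S_k$ be the set of all integers $i$ with $k^2\leq i\leq 2k^2$ and $i\equiv k-1 \pmod k$, and let $\mathcal{G}_k$ be the set of all graphs all of whose vertex degrees lie in $S_k$. If every graph in $\mathcal{G}_k$ has a $\frac{1}{k}$-majority $(k+1)$-edge-colouring, then every graph with minimum degree at least $k^2$ has a $\frac{1}{k}$-majority $(k+1)$-edge-colouring.
   Context: Graphs are finite and simple. For an integer $k\geq 2$, a $\frac{1}{k}$-majority $l$-edge-colouring of a graph $G$ is an assignment to each edge of $G$ of one of $l$ colours such that for every colour $i$ and every vertex $v$ of $G$, at most $\frac{d_G(v)}{k}$ of the edges incident with $v$ have colour $i$ (where $d_G(v)$ is the degree of $v$). -}

module Defs where

open import Data.Nat using (ℕ; zero; suc; _+_; _*_; _≤_; _%_)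
open import Data.Fin using (Fin; zero; suc)
open import Data.Bool using (Bool; true; false; _∧_)
open import Data.Product using (_×_; Σ)
open import Data.Nat.Divisibility using (_∣_)
open import Relation.Binary.PropositionalEquality using (_≡_)
open import Relation.Nullary.Decidable using (⌊_⌋)
open import Data.Fin.Properties using () renaming (_≟_ to _≟ᶠ_)

count : ∀ {n} → (Fin n → Bool) → ℕ
count {zero}  p = 0
count {suc n} p = b2n (p zero) + count (λ i → p (suc i))
  where
  b2n : Bool → ℕ
  b2n true  = 1
  b2n false = 0

record Graph (n : ℕ) : Set where
  field
    adj   : Fin n → Fin n → Bool
    sym   : ∀ u v → adj u v ≡ adj v u
    loopless : ∀ v → adj v v ≡ false

open Graph public

degree : ∀ {n} → Graph n → Fin n → ℕ
degree G v = count (λ u → adj G v u)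

-- An l-edge-colouring: a colour for each (unordered) pair; only values on
-- edges matter, symmetry makes it a function on unordered edges.
record EdgeColouring {n} (G : Graph n) (l : ℕ) : Set where
  field
    col    : Fin n → Fin n → Fin l
    colSym : ∀ u v → col u v ≡ col v u

open EdgeColouring public

colourDegree : ∀ {n l} {G : Graph n} → EdgeColouring G l → Fin n → Fin l → ℕ
colourDegree {G = G} c v i = count (λ u → adj G v u ∧ ⌊ col c v u ≟ᶠ i ⌋)

-- 1/k-majority: for all colours i and vertices v, (#edges of colour i at v) ≤ d(v)/k,
-- written without division as k * (#) ≤ d(v).
IsMajority : ∀ {n l} {G : Graph n} → ℕ → EdgeColouring G l → Set
IsMajority {n} {l} {G} k c = ∀ (v : Fin n) (i : Fin l) → k * colourDegree c v i ≤ degree G v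

HasMajorityColouring : ∀ {n} → ℕ → ℕ → Graph n → Set
HasMajorityColouring {n} k l G = Σ (EdgeColouring G l) (IsMajority k)

-- S_k = { i : k² ≤ i ≤ 2k², i ≡ k-1 (mod k) }; the congruence i ≡ k-1 (mod k)
-- is written as k ∣ i + 1.
InS : (k : ℕ) → ℕ → Set
InS k i = (k * k ≤ i) × (i ≤ 2 * (k * k)) × (k ∣ suc i)

MinDegreeAtLeast : ∀ {n} → Graph n → ℕ → Set
MinDegreeAtLeast {n} G d = ∀ (v : Fin n) → d ≤ degree G v

-- Two reductions, each of which transfers 1/k-majority colourings back to the
-- original graph.  Splitting: while some vertex v has degree d ≥ 2k², a new
-- vertex takes over all but k² of the edges at v; both pieces have degree ≥ k²,
-- and the colour counts and degrees of the two pieces add up to those of v.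
-- The total excess Σ (d(x) − k²) drops, so eventually all degrees lie in
-- [k², 2k²).  Padding: take two disjoint copies of G and join the two copies of
-- every vertex x with k ∤ d(x) + 1; on one copy a majority colouring of this
-- graph is a majority colouring of G, because k·c ≤ d + 1 and k ∤ d + 1 force
-- k·c ≤ d.  Each round moves every degree one step towards −1 mod k without
-- leaving [k², 2k²], so after k rounds all degrees lie in S_k.

module Submission where

open import Defs hiding (sym)
open import Data.Bool using (Bool; true; false; _∧_; not; if_then_else_)
open import Data.Bool.Properties using (∧-comm; ∧-zeroʳ; ∧-identityʳ; if-eta)
open import Data.Fin using (Fin; zero; suc; _↑ˡ_; _↑ʳ_; splitAt)
open import Data.Fin.Properties using (_≟_; suc-injective; splitAt-↑ˡ; splitAt-↑ʳ; any?)
open import Data.Nat using (ℕ; zero; suc; _+_; _*_; _∸_; _⊓_; _≤_; _<_; _<ᵇ_; _≤?_; _%_; _/_; z≤n; s≤s; s≤s⁻¹)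
open import Data.Nat.Properties
  using ( +-assoc; +-comm; +-suc; +-identityʳ; +-mono-≤; +-cancelʳ-≤; +-commutativeSemigroup
        ; *-distribˡ-+; *-mono-≤; *-monoʳ-≤; ⊓-zeroʳ; m≤n⇒m⊓n≡m
        ; ≤-reflexive; ≤-trans; <⇒≤; ≰⇒>; ≤∧≢⇒<; m≤m+n; n≤1+n
        ; n∸n≡0; m+n∸n≡m; m∸n≤m; m+[n∸m]≡n; ∸-monoʳ-<; module ≤-Reasoning )
open import Algebra.Properties.CommutativeSemigroup +-commutativeSemigroup using (x∙yz≈y∙xz)
open import Data.Nat.DivMod using (m≡m%n+[m/n]*n; m%n≤n)
open import Data.Nat.Divisibility using (_∣_; _∣?_; divides; ∣-trans; m∣m*n; n∣m*n)
open import Data.Nat.Induction using (<-wellFounded)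
open import Data.Product using (_×_; _,_; ∃-syntax)
open import Data.Sum using (_⊎_; inj₁; inj₂; reduce)
open import Function using (_∘_; const)
open import Induction.WellFounded using (Acc; acc)
open import Relation.Binary.PropositionalEquality
open import Relation.Nullary using (¬_; Dec; yes; no; contradiction)
open import Relation.Nullary.Decidable using (⌊_⌋)

bit : Bool → ℕ
bit true  = 1
bit false = 0

count-suc : ∀ {n} (p : Fin (suc n) → Bool) → count p ≡ bit (p zero) + count (p ∘ suc)
count-suc p with p zero
... | true  = refl
... | false = refl

count-cong : ∀ {n} {p q : Fin n → Bool} → p ≗ q → count p ≡ count q
count-cong {zero}          _  = refl
count-cong {suc n} {p} {q} eq = begin
  count p                         ≡⟨ count-suc p ⟩
  bit (p zero) + count (p ∘ suc)  ≡⟨ cong₂ _+_ (cong bit (eq zero)) (count-cong (eq ∘ suc)) ⟩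
  bit (q zero) + count (q ∘ suc)  ≡⟨ count-suc q ⟨
  count q                         ∎
  where open ≡-Reasoning

count-∧-true : ∀ {n} (p : Fin n → Bool) → count p ≡ count (λ i → p i ∧ true)
count-∧-true p = count-cong (λ i → sym (∧-identityʳ (p i)))

count-cong-on : ∀ {n} (p : Fin n → Bool) {q r : Fin n → Bool} →
                (∀ i → p i ≡ true → q i ≡ r i) → count (λ i → p i ∧ q i) ≡ count (λ i → p i ∧ r i)
count-cong-on p {q} {r} eq = count-cong pointwise
  where
  pointwise : ∀ i → p i ∧ q i ≡ p i ∧ r i
  pointwise i with p i in pi
  ... | true  = eq i pi
  ... | false = refl

count-false : ∀ {n} {p : Fin n → Bool} → (∀ i → p i ≡ false) → count p ≡ 0
count-false {zero}  _   = refl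
count-false {suc n} p≡f rewrite p≡f zero = count-false (p≡f ∘ suc)

count-singleton : ∀ {n} (p : Fin n → Bool) (x : Fin n) →
                  (∀ y → y ≢ x → p y ≡ false) → count p ≡ bit (p x)
count-singleton p zero    out rewrite count-suc p =
  trans (cong (bit (p zero) +_) (count-false (λ y → out (suc y) λ ()))) (+-identityʳ _)
count-singleton p (suc x) out rewrite count-suc p | out zero (λ ()) =
  count-singleton (p ∘ suc) x (λ y y≢x → out (suc y) (y≢x ∘ suc-injective))

count-≟ : ∀ {n} (x : Fin n) (b : Fin n → Bool) → count (λ y → ⌊ y ≟ x ⌋ ∧ b y) ≡ bit (b x)
count-≟ x b = trans (count-singleton _ x off-x) (cong bit at-x)
  where
  off-x : ∀ y → y ≢ x → ⌊ y ≟ x ⌋ ∧ b y ≡ false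
  off-x y y≢x with y ≟ x
  ... | yes y≡x = contradiction y≡x y≢x
  ... | no _    = refl
  at-x : ⌊ x ≟ x ⌋ ∧ b x ≡ b x
  at-x with x ≟ x
  ... | yes _  = refl
  ... | no x≢x = contradiction refl x≢x

count-≟ˡ : ∀ {n} (x : Fin n) (b : Fin n → Bool) → count (λ y → ⌊ x ≟ y ⌋ ∧ b y) ≡ bit (b x)
count-≟ˡ x b = trans (count-cong swap) (count-≟ x b)
  where
  swap : ∀ y → ⌊ x ≟ y ⌋ ∧ b y ≡ ⌊ y ≟ x ⌋ ∧ b y
  swap y with x ≟ y | y ≟ x
  ... | yes _   | yes _   = refl
  ... | no _    | no _    = refl
  ... | yes x≡y | no y≢x  = contradiction (sym x≡y) y≢x
  ... | no x≢y  | yes y≡x = contradiction (sym y≡x) x≢y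

count-split : ∀ {n} (p r : Fin n → Bool) →
              count (λ i → p i ∧ r i) + count (λ i → p i ∧ not (r i)) ≡ count p
count-split {zero}  p r = refl
count-split {suc n} p r
  rewrite count-suc (λ i → p i ∧ r i) | count-suc (λ i → p i ∧ not (r i)) | count-suc p
  with p zero | r zero
... | false | _     = count-split (p ∘ suc) (r ∘ suc)
... | true  | true  = cong suc (count-split (p ∘ suc) (r ∘ suc))
... | true  | false = trans (+-suc _ _) (cong suc (count-split (p ∘ suc) (r ∘ suc)))

count-↑ : ∀ {n m} (p : Fin (n + m) → Bool) →
          count p ≡ count (λ i → p (i ↑ˡ m)) + count (λ i → p (n ↑ʳ i))
count-↑ {zero}      p = refl
count-↑ {suc n} {m} p rewrite count-suc p | count-suc (λ i → p (i ↑ˡ m)) =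
  trans (cong (bit (p zero) +_) (count-↑ {n} (p ∘ suc))) (sym (+-assoc (bit (p zero)) _ _))

rank : ∀ {n} → (Fin n → Bool) → Fin n → ℕ
rank q zero    = 0
rank q (suc i) = bit (q zero) + rank (q ∘ suc) i

count-rank< : ∀ {n} (q : Fin n → Bool) K → count (λ i → q i ∧ (rank q i <ᵇ K)) ≡ K ⊓ count q
count-rank< {zero}  q K = sym (⊓-zeroʳ K)
count-rank< {suc n} q K rewrite count-suc (λ i → q i ∧ (rank q i <ᵇ K)) | count-suc q
  with q zero | K
... | false | K′     = count-rank< (q ∘ suc) K′
... | true  | zero   = count-false (λ i → ∧-zeroʳ (q (suc i)))
... | true  | suc K′ = cong suc (count-rank< (q ∘ suc) K′)

sum : ∀ {n} → (Fin n → ℕ) → ℕ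
sum {zero}  f = 0
sum {suc n} f = f zero + sum (f ∘ suc)

sum-mono : ∀ {n} {f g : Fin n → ℕ} → (∀ x → f x ≤ g x) → sum f ≤ sum g
sum-mono {zero}  _   = z≤n
sum-mono {suc n} f≤g = +-mono-≤ (f≤g zero) (sum-mono (f≤g ∘ suc))

sum-mono-+ : ∀ {n} {f g : Fin n → ℕ} (v : Fin n) {c} →
             (∀ x → f x ≤ g x) → c + f v ≤ g v → c + sum f ≤ sum g
sum-mono-+ {f = f} zero    {c} f≤g c+fv≤gv =
  ≤-trans (≤-reflexive (sym (+-assoc c (f zero) _))) (+-mono-≤ c+fv≤gv (sum-mono (f≤g ∘ suc)))
sum-mono-+ {f = f} (suc v) {c} f≤g c+fv≤gv =
  ≤-trans (≤-reflexive (x∙yz≈y∙xz c (f zero) _))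
          (+-mono-≤ (f≤g zero) (sum-mono-+ v (f≤g ∘ suc) c+fv≤gv))

≤-pred-∤ : ∀ {k m d} → k * m ≤ suc d → ¬ k ∣ suc d → k * m ≤ d
≤-pred-∤ {k} {m} km≤1+d k∤1+d =
  s≤s⁻¹ (≤∧≢⇒< km≤1+d (λ km≡1+d → k∤1+d (subst (k ∣_) km≡1+d (m∣m*n m))))

∣-round-up : ∀ m k → 1 ≤ k → ∃[ j ] j ≤ k × k ∣ m + j
∣-round-up m (suc k′) _ = k ∸ m % k , m∸n≤m k (m % k) , divides (suc (m / k)) m+j≡[1+m/k]k
  where
  k : ℕ
  k = suc k′
  open ≡-Reasoning
  m+j≡[1+m/k]k : m + (k ∸ m % k) ≡ suc (m / k) * k
  m+j≡[1+m/k]k = begin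
    m + (k ∸ m % k)                   ≡⟨ cong (_+ (k ∸ m % k)) (m≡m%n+[m/n]*n m k) ⟩
    m % k + m / k * k + (k ∸ m % k)   ≡⟨ cong (_+ (k ∸ m % k)) (+-comm (m % k) _) ⟩
    m / k * k + m % k + (k ∸ m % k)   ≡⟨ +-assoc (m / k * k) _ _ ⟩
    m / k * k + (m % k + (k ∸ m % k)) ≡⟨ cong (m / k * k +_) (m+[n∸m]≡n (m%n≤n m k)) ⟩
    m / k * k + k                     ≡⟨ +-comm (m / k * k) k ⟩
    suc (m / k) * k                   ∎

-- In G′ the vertex suc x is x, and the new vertex zero takes over the edges vy
-- of G with stays y = false; end x y is the end at x of the edge xy in G′.
module VertexSplit {n} (G : Graph n) (v : Fin n) (stays : Fin n → Bool) where

  moves : Fin n → Fin n → Bool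
  moves x y = ⌊ x ≟ v ⌋ ∧ not (stays y)

  adj′ : Fin (suc n) → Fin (suc n) → Bool
  adj′ zero    zero    = false
  adj′ zero    (suc y) = adj G v y ∧ not (stays y)
  adj′ (suc x) zero    = adj G v x ∧ not (stays x)
  adj′ (suc x) (suc y) = adj G x y ∧ not (moves x y) ∧ not (moves y x)

  adj′-sym : ∀ a b → adj′ a b ≡ adj′ b a
  adj′-sym zero    zero    = refl
  adj′-sym zero    (suc y) = refl
  adj′-sym (suc x) zero    = refl
  adj′-sym (suc x) (suc y) = cong₂ _∧_ (Graph.sym G x y) (∧-comm (not (moves x y)) _)

  adj′-loopless : ∀ a → adj′ a a ≡ false
  adj′-loopless zero    = refl
  adj′-loopless (suc x) = cong (_∧ not (moves x x) ∧ not (moves x x)) (loopless G x)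

  G′ : Graph (suc n)
  G′ = record { adj = adj′ ; sym = adj′-sym ; loopless = adj′-loopless }

  end : Fin n → Fin n → Fin (suc n)
  end x y = if moves x y then zero else suc x

  unsplit : ∀ {l} → EdgeColouring G′ l → EdgeColouring G l
  unsplit c = record { col    = λ x y → col c (end x y) (end y x)
                     ; colSym = λ x y → colSym c (end x y) (end y x) }

  count-adj′-v : ∀ (f₀ f₁ : Fin (suc n) → Bool) →
    count (λ u → adj′ zero u ∧ f₀ u) + count (λ u → adj′ (suc v) u ∧ f₁ u)
      ≡ count (λ y → adj G v y ∧ (if stays y then f₁ (suc y) else f₀ (suc y)))
  count-adj′-v f₀ f₁ rewrite count-suc (λ u → adj′ (suc v) u ∧ f₁ u) | loopless G v =
    trans (cong₂ _+_ (count-cong new) (count-cong old)) (count-split h (not ∘ stays))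
    where
    h : Fin n → Bool
    h y = adj G v y ∧ (if stays y then f₁ (suc y) else f₀ (suc y))
    new : ∀ y → (adj G v y ∧ not (stays y)) ∧ f₀ (suc y) ≡ h y ∧ not (stays y)
    new y with adj G v y | stays y
    ... | false | _     = refl
    ... | true  | true  = sym (∧-zeroʳ _)
    ... | true  | false = sym (∧-identityʳ _)
    old : ∀ y → (adj G v y ∧ not (moves v y) ∧ not (moves y v)) ∧ f₁ (suc y) ≡ h y ∧ not (not (stays y))
    old y with v ≟ v
    ... | no v≢v = contradiction refl v≢v
    ... | yes _ with y ≟ v
    ...   | yes refl rewrite loopless G v = refl
    ...   | no _ with adj G v y | stays y
    ...     | false | _     = refl
    ...     | true  | true  = sym (∧-identityʳ _)
    ...     | true  | false = sym (∧-zeroʳ _)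

  count-adj′-other : ∀ {x} → x ≢ v → ∀ (f : Fin (suc n) → Bool) →
    count (λ u → adj′ (suc x) u ∧ f u) ≡ count (λ y → adj G x y ∧ f (end y x))
  count-adj′-other {x} x≢v f = begin
    count (λ u → adj′ (suc x) u ∧ f u)
      ≡⟨ count-suc (λ u → adj′ (suc x) u ∧ f u) ⟩
    bit ((adj G v x ∧ not (stays x)) ∧ f zero) + count (λ y → adj′ (suc x) (suc y) ∧ f (suc y))
      ≡⟨ cong₂ _+_ edge-to-v (count-cong other-edges) ⟩
    count (λ y → p y ∧ moves y x) + count (λ y → p y ∧ not (moves y x))
      ≡⟨ count-split p (λ y → moves y x) ⟩
    count p ∎
    where
    open ≡-Reasoning
    p : Fin n → Bool
    p y = adj G x y ∧ f (end y x)
    only-v : ∀ y → y ≢ v → p y ∧ moves y x ≡ false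
    only-v y y≢v with y ≟ v
    ... | yes y≡v = contradiction y≡v y≢v
    ... | no _    = ∧-zeroʳ _
    edge-to-v : bit ((adj G v x ∧ not (stays x)) ∧ f zero) ≡ count (λ y → p y ∧ moves y x)
    edge-to-v rewrite count-singleton (λ y → p y ∧ moves y x) v only-v | Graph.sym G x v with v ≟ v
    ... | no v≢v = contradiction refl v≢v
    ... | yes _ with adj G v x | stays x
    ...   | false | _     = refl
    ...   | true  | true  = sym (cong bit (∧-zeroʳ _))
    ...   | true  | false = cong bit (sym (∧-identityʳ _))
    other-edges : ∀ y → adj′ (suc x) (suc y) ∧ f (suc y) ≡ p y ∧ not (moves y x)
    other-edges y with x ≟ v
    ... | yes x≡v = contradiction x≡v x≢v
    ... | no _ with moves y x | adj G x y
    ...   | true  | true  = sym (∧-zeroʳ _)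
    ...   | true  | false = refl
    ...   | false | true  = sym (∧-identityʳ _)
    ...   | false | false = refl

  end-other : ∀ {x} y → x ≢ v → end x y ≡ suc x
  end-other {x} y x≢v with x ≟ v
  ... | yes x≡v = contradiction x≡v x≢v
  ... | no _    = refl

  degree-split-v : degree G′ zero + degree G′ (suc v) ≡ degree G v
  degree-split-v = begin
    degree G′ zero + degree G′ (suc v)
      ≡⟨ cong₂ _+_ (count-∧-true (adj′ zero)) (count-∧-true (adj′ (suc v))) ⟩
    count (λ u → adj′ zero u ∧ true) + count (λ u → adj′ (suc v) u ∧ true)
      ≡⟨ count-adj′-v (const true) (const true) ⟩
    count (λ y → adj G v y ∧ (if stays y then true else true))
      ≡⟨ count-cong (λ y → cong (adj G v y ∧_) (if-eta (stays y))) ⟩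
    count (λ y → adj G v y ∧ true)
      ≡⟨ count-∧-true (adj G v) ⟨
    degree G v ∎
    where open ≡-Reasoning

  degree-stays : degree G′ (suc v) ≡ count (λ y → adj G v y ∧ stays y)
  degree-stays = begin
    degree G′ (suc v)
      ≡⟨ count-∧-true (adj′ (suc v)) ⟩
    count (λ u → adj′ (suc v) u ∧ true)
      ≡⟨ cong (_+ count (λ u → adj′ (suc v) u ∧ true))
              (count-false (λ u → ∧-zeroʳ (adj′ zero u))) ⟨
    count (λ u → adj′ zero u ∧ false) + count (λ u → adj′ (suc v) u ∧ true)
      ≡⟨ count-adj′-v (const false) (const true) ⟩
    count (λ y → adj G v y ∧ (if stays y then true else false))
      ≡⟨ count-cong (λ y → cong (adj G v y ∧_) (if-true-false (stays y))) ⟩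
    count (λ y → adj G v y ∧ stays y) ∎
    where
    open ≡-Reasoning
    if-true-false : ∀ b → (if b then true else false) ≡ b
    if-true-false true  = refl
    if-true-false false = refl

  degree-split-other : ∀ {x} → x ≢ v → degree G′ (suc x) ≡ degree G x
  degree-split-other {x} x≢v =
    trans (count-∧-true (adj′ (suc x)))
      (trans (count-adj′-other x≢v (const true)) (sym (count-∧-true (adj G x))))

  module _ {l} (c : EdgeColouring G′ l) where

    colourDegree-split-v : ∀ i → colourDegree c zero i + colourDegree c (suc v) i ≡ colourDegree (unsplit c) v i
    colourDegree-split-v i =
      trans (count-adj′-v (λ u → ⌊ col c zero u ≟ i ⌋) (λ u → ⌊ col c (suc v) u ≟ i ⌋))
            (count-cong-on (adj G v) colour-at)
      where
      colour-at : ∀ y → adj G v y ≡ true →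
        (if stays y then ⌊ col c (suc v) (suc y) ≟ i ⌋ else ⌊ col c zero (suc y) ≟ i ⌋)
          ≡ ⌊ col c (end v y) (end y v) ≟ i ⌋
      colour-at y vy with y ≟ v
      ... | yes refl = contradiction (trans (sym vy) (loopless G v)) λ ()
      ... | no _ with v ≟ v
      ...   | no v≢v = contradiction refl v≢v
      ...   | yes _ with stays y
      ...     | true  = refl
      ...     | false = refl

    colourDegree-split-other : ∀ {x} → x ≢ v → ∀ i → colourDegree c (suc x) i ≡ colourDegree (unsplit c) x i
    colourDegree-split-other {x} x≢v i =
      trans (count-adj′-other x≢v (λ u → ⌊ col c (suc x) u ≟ i ⌋))
            (count-cong (λ y → cong (λ a → adj G x y ∧ ⌊ col c a (end y x) ≟ i ⌋)
                                    (sym (end-other y x≢v))))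

    unsplit-majority : ∀ {k} → IsMajority k c → IsMajority k (unsplit c)
    unsplit-majority {k} maj x i = by-cases (x ≟ v)
      where
      by-cases : Dec (x ≡ v) → k * colourDegree (unsplit c) x i ≤ degree G x
      by-cases (yes refl) = begin
        k * colourDegree (unsplit c) v i
          ≡⟨ cong (k *_) (colourDegree-split-v i) ⟨
        k * (colourDegree c zero i + colourDegree c (suc v) i)
          ≡⟨ *-distribˡ-+ k _ _ ⟩
        k * colourDegree c zero i + k * colourDegree c (suc v) i
          ≤⟨ +-mono-≤ (maj zero i) (maj (suc v) i) ⟩
        degree G′ zero + degree G′ (suc v)
          ≡⟨ degree-split-v ⟩
        degree G v ∎
        where open ≤-Reasoning
      by-cases (no x≢v) =
        subst₂ _≤_ (cong (k *_) (colourDegree-split-other x≢v i)) (degree-split-other x≢v) (maj (suc x) i)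

  majority-from-split : ∀ {k l} → HasMajorityColouring k l G′ → HasMajorityColouring k l G
  majority-from-split {k} (c , maj) = unsplit c , unsplit-majority c {k} maj

module Doubling {n} (G : Graph n) (pad : Fin n → Bool) where

  adjᵈ : Fin n ⊎ Fin n → Fin n ⊎ Fin n → Bool
  adjᵈ (inj₁ x) (inj₁ y) = adj G x y
  adjᵈ (inj₂ x) (inj₂ y) = adj G x y
  adjᵈ (inj₁ x) (inj₂ y) = ⌊ x ≟ y ⌋ ∧ pad x
  adjᵈ (inj₂ x) (inj₁ y) = ⌊ y ≟ x ⌋ ∧ pad y

  adjᵈ-sym : ∀ s t → adjᵈ s t ≡ adjᵈ t s
  adjᵈ-sym (inj₁ x) (inj₁ y) = Graph.sym G x y
  adjᵈ-sym (inj₂ x) (inj₂ y) = Graph.sym G x y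
  adjᵈ-sym (inj₁ x) (inj₂ y) = refl
  adjᵈ-sym (inj₂ x) (inj₁ y) = refl

  adjᵈ-loopless : ∀ s → adjᵈ s s ≡ false
  adjᵈ-loopless (inj₁ x) = loopless G x
  adjᵈ-loopless (inj₂ x) = loopless G x

  H : Graph (n + n)
  H = record { adj      = λ a b → adjᵈ (splitAt n a) (splitAt n b)
             ; sym      = λ a b → adjᵈ-sym (splitAt n a) (splitAt n b)
             ; loopless = λ a → adjᵈ-loopless (splitAt n a) }

  degree-double : ∀ a → degree H a ≡ degree G (reduce (splitAt n a)) + bit (pad (reduce (splitAt n a)))
  degree-double a = trans (count-↑ {n} (adj H a))
    (trans (cong₂ _+_ (count-cong (λ y → cong (adjᵈ (splitAt n a)) (splitAt-↑ˡ n y n)))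
                      (count-cong (λ y → cong (adjᵈ (splitAt n a)) (splitAt-↑ʳ n n y))))
           (by-copy (splitAt n a)))
    where
    by-copy : ∀ s → count (λ y → adjᵈ s (inj₁ y)) + count (λ y → adjᵈ s (inj₂ y))
                    ≡ degree G (reduce s) + bit (pad (reduce s))
    by-copy (inj₁ x) = cong (degree G x +_) (count-≟ˡ x (λ _ → pad x))
    by-copy (inj₂ x) = trans (+-comm _ (degree G x)) (cong (degree G x +_) (count-≟ x pad))

  degree-double-↑ˡ : ∀ x → degree H (x ↑ˡ n) ≡ degree G x + bit (pad x)
  degree-double-↑ˡ x rewrite degree-double (x ↑ˡ n) | splitAt-↑ˡ n x n = refl

  restrict : ∀ {l} → EdgeColouring H l → EdgeColouring G l
  restrict c = record { col    = λ x y → col c (x ↑ˡ n) (y ↑ˡ n)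
                      ; colSym = λ x y → colSym c (x ↑ˡ n) (y ↑ˡ n) }

  colourDegree-restrict : ∀ {l} (c : EdgeColouring H l) x i →
                          colourDegree (restrict c) x i ≤ colourDegree c (x ↑ˡ n) i
  colourDegree-restrict c x i =
    subst (colourDegree (restrict c) x i ≤_) (sym (count-↑ {n} _))
      (≤-trans (≤-reflexive (count-cong first-copy)) (m≤m+n _ _))
    where
    first-copy : ∀ y → adj G x y ∧ ⌊ col c (x ↑ˡ n) (y ↑ˡ n) ≟ i ⌋
                     ≡ adj H (x ↑ˡ n) (y ↑ˡ n) ∧ ⌊ col c (x ↑ˡ n) (y ↑ˡ n) ≟ i ⌋
    first-copy y rewrite splitAt-↑ˡ n x n | splitAt-↑ˡ n y n = refl

  restrict-majority : ∀ {k l} (c : EdgeColouring H l) → IsMajority k c →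
                      (∀ x → pad x ≡ true → ¬ k ∣ suc (degree G x)) → IsMajority k (restrict c)
  restrict-majority {k} c maj padded x i = drop-pad (pad x) refl bound
    where
    bound : k * colourDegree (restrict c) x i ≤ degree G x + bit (pad x)
    bound = ≤-trans (*-monoʳ-≤ k (colourDegree-restrict c x i))
                    (subst (k * colourDegree c (x ↑ˡ n) i ≤_) (degree-double-↑ˡ x) (maj (x ↑ˡ n) i))
    drop-pad : ∀ b → pad x ≡ b → k * colourDegree (restrict c) x i ≤ degree G x + bit b →
               k * colourDegree (restrict c) x i ≤ degree G x
    drop-pad false _  le = subst (k * colourDegree (restrict c) x i ≤_) (+-identityʳ _) le
    drop-pad true  px le = ≤-pred-∤ (subst (k * colourDegree (restrict c) x i ≤_) (+-comm _ 1) le) (padded x px)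

  majority-from-double : ∀ {k l} → (∀ x → pad x ≡ true → ¬ k ∣ suc (degree G x)) →
                         HasMajorityColouring k l H → HasMajorityColouring k l G
  majority-from-double padded (c , maj) = restrict c , restrict-majority c maj padded

excess : ∀ {n} → ℕ → Graph n → ℕ
excess K G = sum (λ x → degree G x ∸ K)

-- v keeps the edges to its first K neighbours.
module SplitOff {n} (G : Graph n) (v : Fin n) {K} (1≤K : 1 ≤ K) (2K≤d : 2 * K ≤ degree G v) where
  open VertexSplit G v (λ y → rank (adj G v) y <ᵇ K) public

  K+K≤d : K + K ≤ degree G v
  K+K≤d = subst (_≤ degree G v) (cong (K +_) (+-identityʳ K)) 2K≤d

  degree-kept : degree G′ (suc v) ≡ K
  degree-kept = trans degree-stays
    (trans (count-rank< (adj G v) K) (m≤n⇒m⊓n≡m (≤-trans (m≤m+n K K) K+K≤d)))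

  degree-new : degree G′ zero + K ≡ degree G v
  degree-new = trans (cong (degree G′ zero +_) (sym degree-kept)) degree-split-v

  K≤degree-new : K ≤ degree G′ zero
  K≤degree-new = +-cancelʳ-≤ K K (degree G′ zero) (subst (K + K ≤_) (sym degree-new) K+K≤d)

  split-minDegree : MinDegreeAtLeast G K → MinDegreeAtLeast G′ K
  split-minDegree _      zero    = K≤degree-new
  split-minDegree minDeg (suc x) = by-cases (x ≟ v)
    where
    by-cases : Dec (x ≡ v) → K ≤ degree G′ (suc x)
    by-cases (yes refl) = ≤-reflexive (sym degree-kept)
    by-cases (no x≢v)   = subst (K ≤_) (sym (degree-split-other x≢v)) (minDeg x)

  split-excess : excess K G′ < excess K G
  split-excess = sum-mono-+ v elsewhere at-v
    where
    elsewhere : ∀ x → degree G′ (suc x) ∸ K ≤ degree G x ∸ K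
    elsewhere x = by-cases (x ≟ v)
      where
      by-cases : Dec (x ≡ v) → degree G′ (suc x) ∸ K ≤ degree G x ∸ K
      by-cases (yes refl) rewrite degree-kept | n∸n≡0 K = z≤n
      by-cases (no x≢v)   = ≤-reflexive (cong (_∸ K) (degree-split-other x≢v))
    at-v : suc (degree G′ zero ∸ K) + (degree G′ (suc v) ∸ K) ≤ degree G v ∸ K
    at-v rewrite degree-kept | n∸n≡0 K | +-identityʳ (degree G′ zero ∸ K) | sym degree-new
               | m+n∸n≡m (degree G′ zero) K = ∸-monoʳ-< 1≤K K≤degree-new

NearlyInS : ℕ → ℕ → ℕ → Set
NearlyInS k t d = k * k ≤ d × d < 2 * (k * k) × ∃[ j ] j ≤ t × k ∣ suc d + j

nearlyInS-start : ∀ {k d} → 1 ≤ k → k * k ≤ d → d < 2 * (k * k) → NearlyInS k k d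
nearlyInS-start {k} {d} 1≤k lo hi = lo , hi , ∣-round-up (suc d) k 1≤k

nearlyInS⇒InS : ∀ {k d} → NearlyInS k 0 d → InS k d
nearlyInS⇒InS {k} {d} (lo , hi , .0 , z≤n , k∣1+d+0) =
  lo , <⇒≤ hi , subst (k ∣_) (+-identityʳ (suc d)) k∣1+d+0

nearlyInS-pad : ∀ {k t d} → NearlyInS k (suc t) d → NearlyInS k t (d + bit (not ⌊ k ∣? suc d ⌋))
nearlyInS-pad {k} {t} {d} (lo , hi , j , j≤1+t , k∣1+d+j) with k ∣? suc d
... | yes k∣1+d = subst (NearlyInS k t) (sym (+-identityʳ d))
                    (lo , hi , 0 , z≤n , subst (k ∣_) (sym (+-identityʳ (suc d))) k∣1+d)
... | no k∤1+d  =
  subst (NearlyInS k t) (+-comm 1 d) (≤-trans lo (n≤1+n d) , 1+d<2K , one-less j j≤1+t k∣1+d+j)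
  where
  -- 2k² is a multiple of k, so d + 1 < 2k² follows from d < 2k² and k ∤ d + 1
  1+d<2K : suc d < 2 * (k * k)
  1+d<2K = ≤∧≢⇒< hi (λ 1+d≡2K → k∤1+d (subst (k ∣_) (sym 1+d≡2K) (∣-trans (m∣m*n k) (n∣m*n 2))))
  one-less : ∀ j → j ≤ suc t → k ∣ suc d + j → ∃[ j′ ] j′ ≤ t × k ∣ suc (suc d) + j′
  one-less zero    _           k∣1+d+0 = contradiction (subst (k ∣_) (+-identityʳ (suc d)) k∣1+d+0) k∤1+d
  one-less (suc j) (s≤s j≤t) k∣1+d+j = j , j≤t , subst (k ∣_) (+-suc (suc d) j) k∣1+d+j

module _ {k l : ℕ}
  (majority-S : ∀ n (G : Graph n) → (∀ v → InS k (degree G v)) → HasMajorityColouring k l G) where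

  majority-nearlyInS : ∀ t {n} (G : Graph n) → (∀ x → NearlyInS k t (degree G x)) → HasMajorityColouring k l G
  majority-nearlyInS zero    G near = majority-S _ G (nearlyInS⇒InS ∘ near)
  majority-nearlyInS (suc t) {n} G near = majority-from-double {k} padded (majority-nearlyInS t H near-H)
    where
    pad : Fin n → Bool
    pad x = not ⌊ k ∣? suc (degree G x) ⌋
    open Doubling G pad
    padded : ∀ x → pad x ≡ true → ¬ k ∣ suc (degree G x)
    padded x with k ∣? suc (degree G x)
    ... | yes _    = λ ()
    ... | no k∤1+d = λ _ → k∤1+d
    near-H : ∀ a → NearlyInS k t (degree H a)
    near-H a = subst (NearlyInS k t) (sym (degree-double a)) (nearlyInS-pad (near (reduce (splitAt n a))))

  majority-minDegree : 1 ≤ k → ∀ {n} (G : Graph n) → Acc _<_ (excess (k * k) G) →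
                       MinDegreeAtLeast G (k * k) → HasMajorityColouring k l G
  majority-minDegree 1≤k G (acc smaller) minDeg with any? (λ x → 2 * (k * k) ≤? degree G x)
  ... | no ¬big = majority-nearlyInS k G (λ x → nearlyInS-start 1≤k (minDeg x) (≰⇒> (¬big ∘ (x ,_))))
  ... | yes (v , big) =
    majority-from-split {k} (majority-minDegree 1≤k G′ (smaller split-excess) (split-minDegree minDeg))
    where open SplitOff G v (*-mono-≤ 1≤k 1≤k) big

mainTheorem9 : (k : ℕ) → 2 ≤ k →
    (∀ (n : ℕ) (G : Graph n) → (∀ v → InS k (degree G v)) → HasMajorityColouring k (suc k) G) →
    ∀ (n : ℕ) (G : Graph n) → MinDegreeAtLeast G (k * k) → HasMajorityColouring k (suc k) G
mainTheorem9 k 2≤k majority-S n G =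
  majority-minDegree majority-S (≤-trans (s≤s z≤n) 2≤k) G (<-wellFounded _)
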